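{- Let $n\ge 2$ and let $D_n=\langle a,b\mid a^n=e,\ b^2=e,\ bab^{ -1}=a^{ -1}\rangle$. The girth of the intersection hypergraph $\tilde{\Gamma}_\mathcal{H}(D_n)$ lies in $\{2,\infty\}$.
   Context: For a group $G$, let $S$ be the set of all non-trivial proper subgroups of $G$. The intersection hypergraph $\tilde{\Gamma}_\mathcal{H}(G)$ has vertex set $V=\{H\in S \mid H\cap K=\{e\}\text{ for some }K\in S\}$, and a subset $E\subseteq V$ is a hyperedge iff any two distinct members of $E$ intersect trivially and $E$ is maximal among subsets of $V$ with this property. A cycle in a hypergraph is an alternating sequence $v_1E_1v_2E_2\cdots v_kE_kv_1$ ($k\ge 2$) of distinct vertices $v_i$ and distinct hyperedges $E_i$ with $v_i,v_{i+1}\in E_i$ (indices mod $k$); its length is $k$, the number of hyperedges. The girth is the length of a shortest cycle, and is $\infty$ if there is no cycle. -}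

module Defs where

open import Level using (Level; _⊔_) renaming (suc to lsuc; zero to lzero)
open import Data.Nat using (ℕ; zero; suc; _+_; _∸_; _≤_; _<_; NonZero)
open import Data.Nat.DivMod using (_mod_)
open import Data.Fin using (Fin; toℕ)
open import Data.Bool using (Bool; true; false; if_then_else_; _xor_)
open import Data.Product using (Σ; ∃; _×_; _,_)
open import Data.Sum using (_⊎_)
open import Relation.Nullary using (¬_)
open import Relation.Binary.PropositionalEquality using (_≡_; _≢_)

-- The dihedral group D_n of order 2n, concretely:
-- the pair (i , s) stands for a^i b^s  (i taken mod n, s ∈ {0,1}).
-- Multiplication: a^i b^s · a^j b^t = a^(i + (-1)^s j) b^(s+t),
-- using b a b⁻¹ = a⁻¹.

module Dihedral (n : ℕ) .{{_ : NonZero n}} where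

  D : Set
  D = Fin n × Bool

  addₙ : Fin n → Fin n → Fin n
  addₙ i j = (toℕ i + toℕ j) mod n

  negₙ : Fin n → Fin n
  negₙ i = (n ∸ toℕ i) mod n

  e : D
  e = (0 mod n , false)

  _∙_ : D → D → D
  (i , s) ∙ (j , t) = (addₙ i (if s then negₙ j else j) , s xor t)

  _⁻¹ : D → D
  (i , false) ⁻¹ = (negₙ i , false)
  (i , true)  ⁻¹ = (i , true)

-- Subsets of G are predicates G → Set; subsets are identified up to
-- extensional equality _≐_.

module IntersectionHypergraph (G : Set) (e : G) (_∙_ : G → G → G) (_⁻¹ : G → G) where

  SubsetG : Set₁
  SubsetG = G → Set

  _≐_ : SubsetG → SubsetG → Set
  H ≐ K = ∀ x → (H x → K x) × (K x → H x)

  record IsSubgroup (H : SubsetG) : Set where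
    field
      has-e   : H e
      closed∙ : ∀ x y → H x → H y → H (x ∙ y)
      closed⁻¹ : ∀ x → H x → H (x ⁻¹)

  InS : SubsetG → Set
  InS H = IsSubgroup H × (∃ λ x → H x × x ≢ e) × (∃ λ x → ¬ H x)

  TrivInt : SubsetG → SubsetG → Set
  TrivInt H K = ∀ x → H x → K x → x ≡ e

  Vertex : SubsetG → Set₁
  Vertex H = InS H × (∃ λ K → InS K × TrivInt H K)

  Fam : Set₂
  Fam = SubsetG → Set₁

  _⊆F_ : Fam → Fam → Set₁
  E ⊆F F = ∀ H → E H → F H

  _≡F_ : Fam → Fam → Set₁
  E ≡F F = (E ⊆F F) × (F ⊆F E)

  InV : Fam → Set₁
  InV E = ∀ H → E H → Vertex H

  PairwiseTriv : Fam → Set₁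
  PairwiseTriv E = ∀ H K → E H → E K → ¬ (H ≐ K) → TrivInt H K

  IsHyperedge : Fam → Set₂
  IsHyperedge E =
    InV E × PairwiseTriv E ×
    (∀ (E' : Fam) → E ⊆F E' → InV E' → PairwiseTriv E' → E' ⊆F E)

  next : ∀ {k} → Fin k → Fin k
  next {suc k} i = suc (toℕ i) mod suc k

  record Cycle (k : ℕ) : Set₂ where
    field
      2≤k      : 2 ≤ k
      v        : Fin k → SubsetG
      E        : Fin k → Fam
      E-edge   : ∀ i → IsHyperedge (E i)
      v-dist   : ∀ i j → i ≢ j → ¬ (v i ≐ v j)
      E-dist   : ∀ i j → i ≢ j → ¬ (E i ≡F E j)
      v∈E      : ∀ i → E i (v i)
      vnext∈E  : ∀ i → E i (v (next i))

  data ℕ∞ : Set where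
    fin : ℕ → ℕ∞
    ∞   : ℕ∞

  GirthIs : ℕ∞ → Set₂
  GirthIs (fin k) = Cycle k × (∀ j → j < k → ¬ Cycle j)
  GirthIs ∞       = ∀ k → ¬ Cycle k

GirthDₙIn2∞ : (n : ℕ) .{{_ : NonZero n}} → Set₂
GirthDₙIn2∞ n = Σ ℕ∞ λ g → GirthIs g × (g ≡ fin 2 ⊎ g ≡ ∞)
  where
  open Dihedral n
  open IntersectionHypergraph D e _∙_ _⁻¹

{-# OPTIONS --safe #-}
-- If p is prime, every non-trivial proper subgroup of D_p is the rotation
-- subgroup ⟨a⟩ or a reflection subgroup ⟨a^i b⟩, and any subgroup sharing a
-- non-identity element with a proper subgroup H contains H.  Hence all
-- vertices intersect pairwise trivially, the whole vertex set is the only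
-- hyperedge, and there is no cycle.
-- If n is composite, the reflection subgroups together with ⟨a⟩ span one
-- hyperedge, and together with the subgroups of prime order of ⟨a⟩ another.
-- They differ because ⟨a⟩ does not have prime order, and both contain
-- ⟨b⟩ and ⟨ab⟩, which gives a cycle of length 2.
module Submission where

open import Defs
open import Data.Nat using (ℕ; _≤_; NonZero)
open import Data.Nat.Base using (zero; suc; pred; _+_; _*_; _∸_; _<_; _%_; s≤s; z≤n)
open import Data.Nat.Properties
open import Data.Nat.DivMod
open import Data.Nat.Divisibility
open import Data.Nat.Primality using (Prime; prime?; prime⇒irreducible; prime⇒nonZero)
open import Data.Nat.Primality.Factorisation using (factorise; PrimeFactorisation)
import Data.Nat.Coprimality as Coprimality
open Coprimality using (Coprime; coprime-Bézout; coprime-factors; prime⇒coprime)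
open import Data.Nat.GCD using (module Bézout)
open import Data.Nat.ListAction using (product)
open import Data.Nat.Solver using (module +-*-Solver)
open import Data.Fin as Fin using (Fin; toℕ)
open import Data.Fin.Properties using (toℕ-injective; toℕ-fromℕ<; toℕ<n)
open import Data.Bool using (true; false)
import Data.Bool as Bool
open import Data.List using (_∷_; [])
open import Data.List.Relation.Unary.All using (All; _∷_; [])
open import Data.Product using (Σ; ∃; ∃₂; _×_; _,_; proj₁; proj₂; swap)
open import Data.Product.Properties using (≡-dec)
open import Data.Sum using (_⊎_; inj₁; inj₂; [_,_]′)
open import Data.Unit using (⊤; tt)
open import Data.Empty using (⊥; ⊥-elim)
open import Function using (_∘_)
open import Relation.Nullary using (¬_; yes; no; contradiction)
open import Relation.Nullary.Decidable using (decidable-stable)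
open import Relation.Unary using (Decidable)
open import Relation.Binary.Definitions using (DecidableEquality; tri<; tri≈; tri>)
open import Relation.Binary.PropositionalEquality

module HypergraphFacts (G : Set) (e : G) (_∙_ : G → G → G) (_⁻¹ : G → G) where
  open IntersectionHypergraph G e _∙_ _⁻¹

  ≐-refl : ∀ {H} → H ≐ H
  ≐-refl x = (λ h → h) , (λ h → h)

  ≐-sym : ∀ {H K} → H ≐ K → K ≐ H
  ≐-sym H≐K x = swap (H≐K x)

  ≐-trans : ∀ {H K L} → H ≐ K → K ≐ L → H ≐ L
  ≐-trans H≐K K≐L x = proj₁ (K≐L x) ∘ proj₁ (H≐K x) , proj₂ (H≐K x) ∘ proj₂ (K≐L x)

  TrivInt-sym : ∀ {H K} → TrivInt H K → TrivInt K H
  TrivInt-sym triv x kx hx = triv x hx kx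

  _⊆_ : SubsetG → SubsetG → Set
  H ⊆ K = ∀ x → H x → K x

  Meets : SubsetG → SubsetG → Set
  Meets H K = ∃ λ x → H x × K x × x ≢ e

  Vertex⊆hyperedge : PairwiseTriv Vertex → ∀ {E} → IsHyperedge E → Vertex ⊆F E
  Vertex⊆hyperedge triv (E⊆V , _ , maximal) = maximal Vertex E⊆V (λ _ v → v) triv

  unique-hyperedge : PairwiseTriv Vertex → ∀ {E F} → IsHyperedge E → IsHyperedge F → E ≡F F
  unique-hyperedge triv E-hyp F-hyp =
    (λ H → Vertex⊆hyperedge triv F-hyp H ∘ proj₁ E-hyp H) ,
    (λ H → Vertex⊆hyperedge triv E-hyp H ∘ proj₁ F-hyp H)

  acyclic : PairwiseTriv Vertex → ∀ k → ¬ Cycle k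
  acyclic triv (suc (suc k)) c =
    E-dist Fin.zero (Fin.suc Fin.zero) (λ ()) (unique-hyperedge triv (E-edge _) (E-edge _))
    where open Cycle c
  acyclic _ 0 c = contradiction (Cycle.2≤k c) λ ()
  acyclic _ 1 c = contradiction (Cycle.2≤k c) λ { (s≤s ()) }

  cycle₂ : ∀ {E F u v} → IsHyperedge E → IsHyperedge F → ¬ E ≡F F → ¬ u ≐ v →
           E u → E v → F u → F v → Cycle 2
  cycle₂ {E} {F} {u} {v} E-hyp F-hyp E≢F u≉v Eu Ev Fu Fv = record
    { 2≤k = s≤s (s≤s z≤n) ; v = vs ; E = Es ; E-edge = Es-edge ; v-dist = vs-dist
    ; E-dist = Es-dist ; v∈E = vs∈Es ; vnext∈E = vs-next∈Es }
    where
    vs : Fin 2 → SubsetG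
    vs Fin.zero = u
    vs (Fin.suc _) = v

    Es : Fin 2 → Fam
    Es Fin.zero = E
    Es (Fin.suc _) = F

    Es-edge : ∀ i → IsHyperedge (Es i)
    Es-edge Fin.zero = E-hyp
    Es-edge (Fin.suc _) = F-hyp

    vs-dist : ∀ i j → i ≢ j → ¬ vs i ≐ vs j
    vs-dist Fin.zero Fin.zero i≢j = contradiction refl i≢j
    vs-dist Fin.zero (Fin.suc _) _ = u≉v
    vs-dist (Fin.suc _) Fin.zero _ = u≉v ∘ ≐-sym
    vs-dist (Fin.suc Fin.zero) (Fin.suc Fin.zero) i≢j = contradiction refl i≢j

    Es-dist : ∀ i j → i ≢ j → ¬ Es i ≡F Es j
    Es-dist Fin.zero Fin.zero i≢j = contradiction refl i≢j
    Es-dist Fin.zero (Fin.suc _) _ = E≢F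
    Es-dist (Fin.suc _) Fin.zero _ = E≢F ∘ swap
    Es-dist (Fin.suc Fin.zero) (Fin.suc Fin.zero) i≢j = contradiction refl i≢j

    vs∈Es : ∀ i → Es i (vs i)
    vs∈Es Fin.zero = Eu
    vs∈Es (Fin.suc Fin.zero) = Fv

    vs-next∈Es : ∀ i → Es i (vs (next i))
    vs-next∈Es Fin.zero = Ev
    vs-next∈Es (Fin.suc Fin.zero) = Fu

  girth≡2 : Cycle 2 → GirthIs (fin 2)
  girth≡2 c = c , λ j j<2 c′ → <⇒≱ j<2 (Cycle.2≤k c′)

  -- Membership is double-negated: for a subgroup given by an arbitrary
  -- predicate one can refute, but not decide, that it is one of the R k,
  -- and maximality is proved by such a refutation.
  Spanned : {I : Set} → (I → SubsetG) → Fam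
  Spanned R H = Vertex H × ¬ ¬ (∃ λ k → H ≐ R k)

  spanned-∋ : ∀ {I} (R : I → SubsetG) k → Vertex (R k) → Spanned R (R k)
  spanned-∋ R k v = v , λ ∉R → ∉R (k , ≐-refl)

  spanned-isHyperedge : ∀ {I} → DecidableEquality G → (R : I → SubsetG) →
                        (∀ k l → ¬ R k ≐ R l → TrivInt (R k) (R l)) →
                        (∀ H → InS H → ∃ λ k → Vertex (R k) × Meets H (R k)) →
                        IsHyperedge (Spanned R)
  spanned-isHyperedge _≟_ R R-triv R-meets = (λ _ → proj₁) , pairwise , maximal
    where
    pairwise : PairwiseTriv (Spanned R)
    pairwise H K (_ , H∈R) (_ , K∈R) H≉K x hx kx = decidable-stable (x ≟ e) λ x≢e →
      H∈R λ (k , H≐Rk) → K∈R λ (l , K≐Rl) →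
        x≢e (R-triv k l (λ Rk≐Rl → H≉K (≐-trans H≐Rk (≐-trans Rk≐Rl (≐-sym K≐Rl))))
                    x (proj₁ (H≐Rk x) hx) (proj₁ (K≐Rl x) kx))

    maximal : ∀ E′ → Spanned R ⊆F E′ → InV E′ → PairwiseTriv E′ → E′ ⊆F Spanned R
    maximal E′ R⊆E′ E′⊆V E′-triv H h = E′⊆V H h , λ H∉R →
      let (k , vk , x , hx , rx , x≢e) = R-meets H (proj₁ (E′⊆V H h))
      in x≢e (E′-triv H (R k) h (R⊆E′ (R k) (spanned-∋ R k vk)) (λ H≐Rk → H∉R (k , H≐Rk)) x hx rx)

prime-step-into : ∀ {P : ℕ → Set} → Decidable P → ∀ ps c → All Prime ps →
                  ¬ P c → P (product ps * c) → ∃₂ λ q c′ → Prime q × ¬ P c′ × P (q * c′)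
prime-step-into {P} _ [] c [] ¬Pc P[ps*c] = contradiction (subst P (*-identityˡ c) P[ps*c]) ¬Pc
prime-step-into {P} P? (p ∷ ps) c (prime-p ∷ primes) ¬Pc P[ps*c] with P? (p * c)
... | yes P[p*c] = p , c , prime-p , ¬Pc , P[p*c]
... | no ¬P[p*c] = prime-step-into P? ps (p * c) primes ¬P[p*c] (subst P reassoc P[ps*c])
  where
  reassoc : p * product ps * c ≡ product ps * (p * c)
  reassoc = trans (cong (_* c) (*-comm p (product ps))) (*-assoc (product ps) p c)

distinct-primes-coprime : ∀ {p q} → Prime p → Prime q → p ≢ q → Coprime p q
distinct-primes-coprime {p} {q} prime-p prime-q p≢q with <-cmp p q
... | tri< p<q _ _ = Coprimality.sym (prime⇒coprime prime-q {{prime⇒nonZero prime-p}} p<q)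
... | tri≈ _ p≡q _ = contradiction p≡q p≢q
... | tri> _ _ q<p = prime⇒coprime prime-p {{prime⇒nonZero prime-q}} q<p

[m%n+k]%n≡[m+k]%n : ∀ m k n .{{_ : NonZero n}} → (m % n + k) % n ≡ (m + k) % n
[m%n+k]%n≡[m+k]%n m k n = begin
  (m % n + k) % n           ≡⟨ %-distribˡ-+ (m % n) k n ⟩
  (m % n % n + k % n) % n   ≡⟨ cong (λ z → (z + k % n) % n) (m%n%n≡m%n m n) ⟩
  (m % n + k % n) % n       ≡⟨ %-distribˡ-+ m k n ⟨
  (m + k) % n               ∎
  where open ≡-Reasoning

[m+k%n]%n≡[m+k]%n : ∀ m k n .{{_ : NonZero n}} → (m + k % n) % n ≡ (m + k) % n
[m+k%n]%n≡[m+k]%n m k n = begin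
  (m + k % n) % n   ≡⟨ cong (_% n) (+-comm m (k % n)) ⟩
  (k % n + m) % n   ≡⟨ [m%n+k]%n≡[m+k]%n k m n ⟩
  (k + m) % n       ≡⟨ cong (_% n) (+-comm k m) ⟩
  (m + k) % n       ∎
  where open ≡-Reasoning

[a+[n∸b]+b]%n≡a : ∀ {a b n} .{{_ : NonZero n}} → a < n → b ≤ n → (a + (n ∸ b) + b) % n ≡ a
[a+[n∸b]+b]%n≡a {a} {b} {n} a<n b≤n = begin
  (a + (n ∸ b) + b) % n   ≡⟨ cong (_% n) (+-assoc a (n ∸ b) b) ⟩
  (a + (n ∸ b + b)) % n   ≡⟨ cong (λ z → (a + z) % n) (m∸n+n≡m b≤n) ⟩
  (a + n) % n             ≡⟨ [m+n]%n≡m%n a n ⟩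
  a % n                   ≡⟨ m<n⇒m%n≡m a<n ⟩
  a                       ∎
  where open ≡-Reasoning

n∣m*k⇒n∣m*[k%n] : ∀ {n m k} .{{_ : NonZero n}} → n ∣ m * k → n ∣ m * (k % n)
n∣m*k⇒n∣m*[k%n] {n} {m} {k} n∣m*k = m%n≡0⇒n∣m (m * (k % n)) n (begin
  (m * (k % n)) % n           ≡⟨ %-distribˡ-* m (k % n) n ⟩
  (m % n * (k % n % n)) % n   ≡⟨ cong (λ z → (m % n * z) % n) (m%n%n≡m%n k n) ⟩
  (m % n * (k % n)) % n       ≡⟨ %-distribˡ-* m k n ⟨
  (m * k) % n                 ≡⟨ n∣m⇒m%n≡0 (m * k) n n∣m*k ⟩
  0                           ∎)
  where open ≡-Reasoning

module _ {n : ℕ} .{{_ : NonZero n}} where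

  toℕ-mod : ∀ k → toℕ (k mod n) ≡ k % n
  toℕ-mod k = toℕ-fromℕ< (m%n<n k n)

  mod-toℕ : (j : Fin n) → toℕ j mod n ≡ j
  mod-toℕ j = toℕ-injective (trans (toℕ-mod (toℕ j)) (m<n⇒m%n≡m (toℕ<n j)))

  mod-cong : ∀ k l → k % n ≡ l % n → k mod n ≡ l mod n
  mod-cong k l eq = toℕ-injective (trans (toℕ-mod k) (trans eq (sym (toℕ-mod l))))

  modular-inverse : ∀ {t} → Coprime n t → ∃ λ u → (u * t) % n ≡ 1 % n
  modular-inverse {t} n⊥t with coprime-Bézout n⊥t
  ... | Bézout.-+ x y 1+xn≡yt = y , (begin
    (y * t) % n       ≡⟨ cong (_% n) 1+xn≡yt ⟨
    (1 + x * n) % n   ≡⟨ [m+kn]%n≡m%n 1 x n ⟩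
    1 % n             ∎)
    where open ≡-Reasoning
  -- Here y * t ≡ -1 (mod n), so pred n * y inverts t.
  ... | Bézout.+- x y 1+yt≡xn = pred n * y , (begin
    (pred n * y * t) % n                 ≡⟨ [m+kn]%n≡m%n _ x n ⟨
    (pred n * y * t + x * n) % n         ≡⟨ cong (λ z → (pred n * y * t + z) % n) 1+yt≡xn ⟨
    (pred n * y * t + (1 + y * t)) % n   ≡⟨ cong (_% n) (regroup (pred n) y t) ⟩
    (1 + y * t * suc (pred n)) % n       ≡⟨ cong (λ z → (1 + y * t * z) % n) (suc-pred n) ⟩
    (1 + y * t * n) % n                  ≡⟨ [m+kn]%n≡m%n 1 (y * t) n ⟩
    1 % n                                ∎)
    where
    open ≡-Reasoning
    open +-*-Solver
    regroup : ∀ p y t → p * y * t + (1 + y * t) ≡ 1 + y * t * suc p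
    regroup = solve 3
      (λ p y t → p :* y :* t :+ (con 1 :+ y :* t) := con 1 :+ y :* t :* (con 1 :+ p)) refl

  prime-order-multiple : ∀ {t} → ¬ n ∣ t → ∃₂ λ q c → Prime q × ¬ n ∣ c * t × n ∣ q * (c * t)
  prime-order-multiple {t} n∤t
    with prime-step-into (λ c → n ∣? c * t) factors 1 factorsPrime
           (n∤t ∘ subst (n ∣_) (*-identityˡ t))
           (∣m⇒∣m*n t (∣m⇒∣m*n 1 (∣-reflexive isFactorisation)))
    where open PrimeFactorisation (factorise n)
  ... | q , c , prime-q , n∤ct , n∣qct = q , c , prime-q , n∤ct , subst (n ∣_) (*-assoc q c t) n∣qct

module DihedralGroup (m : ℕ) where
  n : ℕ
  n = 2 + m

  open Dihedral n
  open IntersectionHypergraph D e _∙_ _⁻¹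
  open HypergraphFacts D e _∙_ _⁻¹
  open IsSubgroup

  private variable
    H K : SubsetG
    i j : Fin n
    k : ℕ

  _≟ᴰ_ : DecidableEquality D
  _≟ᴰ_ = ≡-dec Fin._≟_ Bool._≟_

  rot : ℕ → D
  rot k = (k mod n , false)

  rot-cong : ∀ k l → k % n ≡ l % n → rot k ≡ rot l
  rot-cong k l = cong (_, false) ∘ mod-cong k l

  rotation≡rot : (j : Fin n) → (j , false) ≡ rot (toℕ j)
  rotation≡rot j = cong (_, false) (sym (mod-toℕ j))

  rot-+ : ∀ k l → rot k ∙ rot l ≡ rot (k + l)
  rot-+ k l = rot-cong (toℕ (k mod n) + toℕ (l mod n)) (k + l) (begin
    (toℕ (k mod n) + toℕ (l mod n)) % n   ≡⟨ cong₂ (λ x y → (x + y) % n) (toℕ-mod k) (toℕ-mod l) ⟩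
    (k % n + l % n) % n                   ≡⟨ %-distribˡ-+ k l n ⟨
    (k + l) % n                           ∎)
    where open ≡-Reasoning

  rot≡e⇒n∣ : rot k ≡ e → n ∣ k
  rot≡e⇒n∣ {k} eq = m%n≡0⇒n∣m k n (trans (sym (toℕ-mod k)) (cong (toℕ ∘ proj₁) eq))

  n∣⇒rot≡e : n ∣ k → rot k ≡ e
  n∣⇒rot≡e {k} n∣k = rot-cong k 0 (n∣m⇒m%n≡0 k n n∣k)

  rotation≢e⇒n∤ : (j , false) ≢ e → ¬ n ∣ toℕ j
  rotation≢e⇒n∤ {j} j≢e = j≢e ∘ trans (rotation≡rot j) ∘ n∣⇒rot≡e

  rot-closed : IsSubgroup H → H (rot k) → ∀ c → H (rot (c * k))
  rot-closed sg h zero = has-e sg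
  rot-closed {H} {k} sg h (suc c) = subst H (rot-+ k (c * k)) (closed∙ sg _ _ h (rot-closed sg h c))

  e-∙ : ∀ x → e ∙ x ≡ x
  e-∙ (j , s) = cong (_, s) (mod-toℕ j)

  reflection-∙-e : (i , true) ∙ e ≡ (i , true)
  reflection-∙-e {i} = cong (_, true) (trans (mod-cong (toℕ i + toℕ (n mod n)) (toℕ i) (begin
    (toℕ i + toℕ (n mod n)) % n   ≡⟨ cong (λ z → (toℕ i + z) % n) (toℕ-mod n) ⟩
    (toℕ i + n % n) % n           ≡⟨ [m+k%n]%n≡[m+k]%n (toℕ i) n n ⟩
    (toℕ i + n) % n               ≡⟨ [m+n]%n≡m%n (toℕ i) n ⟩
    toℕ i % n                     ∎)) (mod-toℕ i))
    where open ≡-Reasoning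

  e⁻¹≡e : e ⁻¹ ≡ e
  e⁻¹≡e = n∣⇒rot≡e ∣-refl

  reflection-involutive : (i , true) ∙ (i , true) ≡ e
  reflection-involutive {i} = rot-cong (toℕ i + toℕ (negₙ i)) 0 (begin
    (toℕ i + toℕ (negₙ i)) % n      ≡⟨ cong (λ z → (toℕ i + z) % n) (toℕ-mod (n ∸ toℕ i)) ⟩
    (toℕ i + (n ∸ toℕ i) % n) % n   ≡⟨ [m+k%n]%n≡[m+k]%n (toℕ i) (n ∸ toℕ i) n ⟩
    (toℕ i + (n ∸ toℕ i)) % n       ≡⟨ cong (_% n) (m+[n∸m]≡n (<⇒≤ (toℕ<n i))) ⟩
    n % n                           ≡⟨ n%n≡0 n ⟩
    0                               ∎)
    where open ≡-Reasoning

  reflections-∙≡e⇒≡ : (j , true) ∙ (i , true) ≡ e → j ≡ i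
  reflections-∙≡e⇒≡ {j} {i} eq = toℕ-injective (begin
    toℕ j                 ≡⟨ [a+[n∸b]+b]%n≡a (toℕ<n j) (<⇒≤ (toℕ<n i)) ⟨
    (d + toℕ i) % n       ≡⟨ [m%n+k]%n≡[m+k]%n d (toℕ i) n ⟨
    (d % n + toℕ i) % n   ≡⟨ cong (λ z → (z + toℕ i) % n) d%n≡0 ⟩
    toℕ i % n             ≡⟨ m<n⇒m%n≡m (toℕ<n i) ⟩
    toℕ i                 ∎)
    where
    open ≡-Reasoning
    d : ℕ
    d = toℕ j + (n ∸ toℕ i)
    d%n≡0 : d % n ≡ 0
    d%n≡0 = begin
      d % n                           ≡⟨ [m+k%n]%n≡[m+k]%n (toℕ j) (n ∸ toℕ i) n ⟨
      (toℕ j + (n ∸ toℕ i) % n) % n   ≡⟨ cong (λ z → (toℕ j + z) % n) (toℕ-mod (n ∸ toℕ i)) ⟨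
      (toℕ j + toℕ (negₙ i)) % n      ≡⟨ n∣m⇒m%n≡0 (toℕ j + toℕ (negₙ i)) n (rot≡e⇒n∣ eq) ⟩
      0                               ∎

  rotation-∙-reflection : ∀ l i → rot (toℕ l + (n ∸ toℕ i)) ∙ (i , true) ≡ (l , true)
  rotation-∙-reflection l i = cong (_, true) (toℕ-injective (begin
    toℕ (addₙ (t mod n) i)        ≡⟨ toℕ-mod (toℕ (t mod n) + toℕ i) ⟩
    (toℕ (t mod n) + toℕ i) % n   ≡⟨ cong (λ z → (z + toℕ i) % n) (toℕ-mod t) ⟩
    (t % n + toℕ i) % n           ≡⟨ [m%n+k]%n≡[m+k]%n t (toℕ i) n ⟩
    (t + toℕ i) % n               ≡⟨ [a+[n∸b]+b]%n≡a (toℕ<n l) (<⇒≤ (toℕ<n i)) ⟩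
    toℕ l                         ∎))
    where
    open ≡-Reasoning
    t : ℕ
    t = toℕ l + (n ∸ toℕ i)

  ⟨a⟩ : SubsetG
  ⟨a⟩ (_ , s) = s ≡ false

  ⟨a^_b⟩ : Fin n → SubsetG
  ⟨a^ i b⟩ x = x ≡ e ⊎ x ≡ (i , true)

  -- The rotations x with x ^ q ≡ e; for a prime q ∣ n, the subgroup of order q.
  Torsion : ℕ → SubsetG
  Torsion q (j , s) = s ≡ false × n ∣ q * toℕ j

  ⟨a⟩-isSubgroup : IsSubgroup ⟨a⟩
  ⟨a⟩-isSubgroup = record { has-e = refl ; closed∙ = closed ; closed⁻¹ = inverse }
    where
    closed : ∀ x y → ⟨a⟩ x → ⟨a⟩ y → ⟨a⟩ (x ∙ y)
    closed (_ , false) (_ , false) _ _ = refl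
    inverse : ∀ x → ⟨a⟩ x → ⟨a⟩ (x ⁻¹)
    inverse (_ , false) _ = refl

  ⟨a^b⟩-isSubgroup : ∀ i → IsSubgroup ⟨a^ i b⟩
  ⟨a^b⟩-isSubgroup i = record { has-e = inj₁ refl ; closed∙ = closed ; closed⁻¹ = inverse }
    where
    closed : ∀ x y → ⟨a^ i b⟩ x → ⟨a^ i b⟩ y → ⟨a^ i b⟩ (x ∙ y)
    closed _ y (inj₁ refl) y∈ = subst ⟨a^ i b⟩ (sym (e-∙ y)) y∈
    closed _ _ (inj₂ refl) (inj₁ refl) = inj₂ (reflection-∙-e {i})
    closed _ _ (inj₂ refl) (inj₂ refl) = inj₁ (reflection-involutive {i})
    inverse : ∀ x → ⟨a^ i b⟩ x → ⟨a^ i b⟩ (x ⁻¹)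
    inverse _ (inj₁ refl) = inj₁ e⁻¹≡e
    inverse _ (inj₂ refl) = inj₂ refl

  torsion-rot : ∀ q k → n ∣ q * k → Torsion q (rot k)
  torsion-rot q k n∣qk =
    refl , subst (λ z → n ∣ q * z) (sym (toℕ-mod k)) (n∣m*k⇒n∣m*[k%n] {m = q} n∣qk)

  Torsion-isSubgroup : ∀ q → IsSubgroup (Torsion q)
  Torsion-isSubgroup q = record
    { has-e = refl , subst (n ∣_) (sym (*-zeroʳ q)) (n ∣0) ; closed∙ = closed ; closed⁻¹ = inverse }
    where
    closed : ∀ x y → Torsion q x → Torsion q y → Torsion q (x ∙ y)
    closed (j , false) (l , false) (_ , n∣qj) (_ , n∣ql) = torsion-rot q (toℕ j + toℕ l)
      (subst (n ∣_) (sym (*-distribˡ-+ q (toℕ j) (toℕ l))) (∣m∣n⇒∣m+n n∣qj n∣ql))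
    inverse : ∀ x → Torsion q x → Torsion q (x ⁻¹)
    inverse (j , false) (_ , n∣qj) = torsion-rot q (n ∸ toℕ j) (∣m+n∣m⇒∣n n∣qj+q[n∸j] n∣qj)
      where
      n∣qj+q[n∸j] : n ∣ q * toℕ j + q * (n ∸ toℕ j)
      n∣qj+q[n∸j] = subst (n ∣_)
        (trans (cong (q *_) (sym (m+[n∸m]≡n (<⇒≤ (toℕ<n j))))) (*-distribˡ-+ q _ _)) (n∣m*n q)

  ⟨a⟩-InS : InS ⟨a⟩
  ⟨a⟩-InS = ⟨a⟩-isSubgroup , (rot 1 , refl , λ ()) , ((Fin.zero , true) , λ ())

  ⟨a^b⟩-InS : InS ⟨a^ i b⟩
  ⟨a^b⟩-InS {i} =
    ⟨a^b⟩-isSubgroup i , ((i , true) , inj₂ refl , λ ()) , (rot 1 , λ { (inj₁ ()) ; (inj₂ ()) })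

  rotations-meet-⟨a^b⟩-trivially : K ⊆ ⟨a⟩ → TrivInt ⟨a^ i b⟩ K
  rotations-meet-⟨a^b⟩-trivially _ _ (inj₁ x≡e) _ = x≡e
  rotations-meet-⟨a^b⟩-trivially K⊆⟨a⟩ _ (inj₂ refl) kx with K⊆⟨a⟩ _ kx
  ... | ()

  ⟨a^b⟩-Vertex : Vertex ⟨a^ i b⟩
  ⟨a^b⟩-Vertex = ⟨a^b⟩-InS , ⟨a⟩ , ⟨a⟩-InS , rotations-meet-⟨a^b⟩-trivially (λ _ x∈ → x∈)

  ⟨a⟩-Vertex : Vertex ⟨a⟩
  ⟨a⟩-Vertex = ⟨a⟩-InS , ⟨a^ Fin.zero b⟩ , ⟨a^b⟩-InS ,
    TrivInt-sym (rotations-meet-⟨a^b⟩-trivially (λ _ x∈ → x∈))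

  Torsion-Vertex : ∀ {q x} → Torsion q x → x ≢ e → Vertex (Torsion q)
  Torsion-Vertex {q} x∈ x≢e =
    (Torsion-isSubgroup q , (_ , x∈ , x≢e) , ((Fin.zero , true) , λ { (() , _) })) ,
    ⟨a^ Fin.zero b⟩ , ⟨a^b⟩-InS , TrivInt-sym (rotations-meet-⟨a^b⟩-trivially (λ _ → proj₁))

  ⟨a^b⟩-distinct-meet-trivially : ¬ ⟨a^ i b⟩ ≐ ⟨a^ j b⟩ → TrivInt ⟨a^ i b⟩ ⟨a^ j b⟩
  ⟨a^b⟩-distinct-meet-trivially _ _ (inj₁ x≡e) _ = x≡e
  ⟨a^b⟩-distinct-meet-trivially _ _ (inj₂ _) (inj₁ x≡e) = x≡e
  ⟨a^b⟩-distinct-meet-trivially i≉j _ (inj₂ refl) (inj₂ refl) = contradiction ≐-refl i≉j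

  Torsion-distinct-meet-trivially : ∀ {q q′} → Prime q → Prime q′ →
                                    ¬ Torsion q ≐ Torsion q′ → TrivInt (Torsion q) (Torsion q′)
  Torsion-distinct-meet-trivially {q} {q′} prime-q prime-q′ q≉q′ (j , false) (_ , n∣qj) (_ , n∣q′j)
    with q ≟ q′
  ... | yes refl = contradiction ≐-refl q≉q′
  ... | no q≢q′ = trans (rotation≡rot j) (n∣⇒rot≡e
    (coprime-factors (distinct-primes-coprime prime-q prime-q′ q≢q′) (n∣qj , n∣q′j)))

  R₁ : Fin n ⊎ ⊤ → SubsetG
  R₁ = [ ⟨a^_b⟩ , (λ _ → ⟨a⟩) ]′

  R₁-isHyperedge : IsHyperedge (Spanned R₁)
  R₁-isHyperedge = spanned-isHyperedge _≟ᴰ_ R₁ triv meets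
    where
    triv : ∀ k l → ¬ R₁ k ≐ R₁ l → TrivInt (R₁ k) (R₁ l)
    triv (inj₁ _) (inj₁ _) = ⟨a^b⟩-distinct-meet-trivially
    triv (inj₁ _) (inj₂ _) _ = rotations-meet-⟨a^b⟩-trivially (λ _ x∈ → x∈)
    triv (inj₂ _) (inj₁ _) _ = TrivInt-sym (rotations-meet-⟨a^b⟩-trivially (λ _ x∈ → x∈))
    triv (inj₂ _) (inj₂ _) ⟨a⟩≉⟨a⟩ = contradiction ≐-refl ⟨a⟩≉⟨a⟩
    meets : ∀ H → InS H → ∃ λ k → Vertex (R₁ k) × Meets H (R₁ k)
    meets _ (_ , ((i , true) , hx , x≢e) , _) = inj₁ i , ⟨a^b⟩-Vertex , _ , hx , inj₂ refl , x≢e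
    meets _ (_ , ((j , false) , hx , x≢e) , _) = inj₂ tt , ⟨a⟩-Vertex , _ , hx , refl , x≢e

  R₂ : Fin n ⊎ Σ ℕ Prime → SubsetG
  R₂ = [ ⟨a^_b⟩ , Torsion ∘ proj₁ ]′

  R₂-isHyperedge : IsHyperedge (Spanned R₂)
  R₂-isHyperedge = spanned-isHyperedge _≟ᴰ_ R₂ triv meets
    where
    triv : ∀ k l → ¬ R₂ k ≐ R₂ l → TrivInt (R₂ k) (R₂ l)
    triv (inj₁ _) (inj₁ _) = ⟨a^b⟩-distinct-meet-trivially
    triv (inj₁ _) (inj₂ _) _ = rotations-meet-⟨a^b⟩-trivially (λ _ → proj₁)
    triv (inj₂ _) (inj₁ _) _ = TrivInt-sym (rotations-meet-⟨a^b⟩-trivially (λ _ → proj₁))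
    triv (inj₂ (_ , prime-q)) (inj₂ (_ , prime-q′)) =
      Torsion-distinct-meet-trivially prime-q prime-q′
    meets : ∀ H → InS H → ∃ λ k → Vertex (R₂ k) × Meets H (R₂ k)
    meets _ (_ , ((i , true) , hx , x≢e) , _) = inj₁ i , ⟨a^b⟩-Vertex , _ , hx , inj₂ refl , x≢e
    meets H (sg , ((j , false) , hx , x≢e) , _)
      with prime-order-multiple (rotation≢e⇒n∤ x≢e)
    ... | q , c , prime-q , n∤cj , n∣qcj =
      inj₂ (q , prime-q) , Torsion-Vertex {q} y∈ y≢e ,
      rot (c * toℕ j) , rot-closed sg (subst H (rotation≡rot j) hx) c , y∈ , y≢e
      where
      y∈ : Torsion q (rot (c * toℕ j))
      y∈ = torsion-rot q (c * toℕ j) n∣qcj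
      y≢e : rot (c * toℕ j) ≢ e
      y≢e = n∤cj ∘ rot≡e⇒n∣

  ⟨a⟩∉R₂ : ¬ Prime n → ¬ Spanned R₂ ⟨a⟩
  ⟨a⟩∉R₂ ¬prime-n (_ , ∈R₂) = ∈R₂ ⟨a⟩≉R₂
    where
    ⟨a⟩≉R₂ : ¬ ∃ λ k → ⟨a⟩ ≐ R₂ k
    ⟨a⟩≉R₂ (inj₁ i , ⟨a⟩≐) with proj₁ (⟨a⟩≐ (rot 1)) refl
    ... | inj₁ ()
    ... | inj₂ ()
    ⟨a⟩≉R₂ (inj₂ (q , prime-q) , ⟨a⟩≐)
      with prime⇒irreducible prime-q
             (subst (n ∣_) (*-identityʳ q) (proj₂ (proj₁ (⟨a⟩≐ (rot 1)) refl)))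
    ... | inj₂ refl = ¬prime-n prime-q

  two-cycle : ¬ Prime n → Cycle 2
  two-cycle ¬prime-n = cycle₂ R₁-isHyperedge R₂-isHyperedge
    (λ (R₁⊆R₂ , _) → ⟨a⟩∉R₂ ¬prime-n (R₁⊆R₂ ⟨a⟩ (spanned-∋ R₁ (inj₂ tt) ⟨a⟩-Vertex)))
    (λ ⟨b⟩≐⟨ab⟩ → case-distinct (proj₁ (⟨b⟩≐⟨ab⟩ (Fin.zero , true)) (inj₂ refl)))
    (spanned-∋ R₁ (inj₁ Fin.zero) ⟨a^b⟩-Vertex)
    (spanned-∋ R₁ (inj₁ (Fin.suc Fin.zero)) ⟨a^b⟩-Vertex)
    (spanned-∋ R₂ (inj₁ Fin.zero) ⟨a^b⟩-Vertex)
    (spanned-∋ R₂ (inj₁ (Fin.suc Fin.zero)) ⟨a^b⟩-Vertex)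
    where
    case-distinct : ⟨a^ Fin.suc Fin.zero b⟩ (Fin.zero , true) → ⊥
    case-distinct (inj₁ ())
    case-distinct (inj₂ ())

  rotation-generates-⟨a⟩ : Prime n → IsSubgroup H → H (j , false) → (j , false) ≢ e → ⟨a⟩ ⊆ H
  rotation-generates-⟨a⟩ {j = Fin.zero} _ _ _ j≢e _ _ = contradiction refl j≢e
  rotation-generates-⟨a⟩ {H} {Fin.suc j} prime-n sg hj _ (l , false) refl =
    subst H (trans (cong rot (*-identityʳ (toℕ l))) (sym (rotation≡rot l)))
      (rot-closed sg h₁ (toℕ l))
    where
    inverse : ∃ λ u → (u * toℕ (Fin.suc j)) % n ≡ 1 % n
    inverse = modular-inverse (prime⇒coprime prime-n (toℕ<n (Fin.suc j)))
    h₁ : H (rot 1)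
    h₁ = subst H (rot-cong (proj₁ inverse * toℕ (Fin.suc j)) 1 (proj₂ inverse))
           (rot-closed sg (subst H (rotation≡rot (Fin.suc j)) hj) (proj₁ inverse))

  ⟨a⟩-and-reflection-generate : IsSubgroup H → ⟨a⟩ ⊆ H → H (i , true) → ∀ x → H x
  ⟨a⟩-and-reflection-generate _ ⟨a⟩⊆H _ (l , false) = ⟨a⟩⊆H _ refl
  ⟨a⟩-and-reflection-generate {H} {i} sg ⟨a⟩⊆H hi (l , true) =
    subst H (rotation-∙-reflection l i)
      (closed∙ sg (rot (toℕ l + (n ∸ toℕ i))) (i , true) (⟨a⟩⊆H _ refl) hi)

  proper-subgroup-⊆ : Prime n → InS H → IsSubgroup K → ∀ x → H x → K x → x ≢ e → H ⊆ K
  proper-subgroup-⊆ {H} {K} prime-n (sgH , _ , z , z∉H) sgK = go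
    where
    not-full : ⟨a⟩ ⊆ H → H (i , true) → ⊥
    not-full ⟨a⟩⊆H hi = z∉H (⟨a⟩-and-reflection-generate sgH ⟨a⟩⊆H hi z)

    go : ∀ x → H x → K x → x ≢ e → H ⊆ K
    go (_ , false) _ kx x≢e (_ , false) _ = rotation-generates-⟨a⟩ prime-n sgK kx x≢e _ refl
    go (_ , false) hx _ x≢e (_ , true) hy =
      ⊥-elim (not-full (rotation-generates-⟨a⟩ prime-n sgH hx x≢e) hy)
    go (_ , true) hx _ _ (l , false) hy with (l , false) ≟ᴰ e
    ... | yes y≡e = subst K (sym y≡e) (has-e sgK)
    ... | no y≢e = ⊥-elim (not-full (rotation-generates-⟨a⟩ prime-n sgH hy y≢e) hx)
    go (i , true) hx kx _ (l , true) hy with l Fin.≟ i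
    ... | yes refl = kx
    ... | no l≢i = ⊥-elim (not-full
      (rotation-generates-⟨a⟩ prime-n sgH (closed∙ sgH _ _ hy hx) (l≢i ∘ reflections-∙≡e⇒≡)) hx)

  vertices-meet-trivially : Prime n → PairwiseTriv Vertex
  vertices-meet-trivially prime-n H K vH vK H≉K x hx kx = decidable-stable (x ≟ᴰ e) λ x≢e →
    H≉K λ y → proper-subgroup-⊆ prime-n (proj₁ vH) (proj₁ (proj₁ vK)) x hx kx x≢e y ,
              proper-subgroup-⊆ prime-n (proj₁ vK) (proj₁ (proj₁ vH)) x kx hx x≢e y

  girth-2-or-∞ : Σ ℕ∞ λ g → GirthIs g × (g ≡ fin 2 ⊎ g ≡ ∞)
  girth-2-or-∞ with prime? n
  ... | yes prime-n = ∞ , acyclic (vertices-meet-trivially prime-n) , inj₂ refl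
  ... | no ¬prime-n = fin 2 , girth≡2 (two-cycle ¬prime-n) , inj₁ refl

mainTheorem7 : (n : ℕ) .{{_ : NonZero n}} → 2 ≤ n → GirthDₙIn2∞ n
mainTheorem7 (suc (suc m)) (s≤s (s≤s z≤n)) = DihedralGroup.girth-2-or-∞ m
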